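{- Let $c,\alpha>0$ and let $m$ be a positive integer with $\alpha\le \frac{c}{m+1}$. Let $T$ be an $\alpha$-coherent tournament with $|V(T)|=n$, and let $A,B_1,\dots,B_m$ be pairwise disjoint subsets of $V(T)$ with $|A|\ge cn$ and $|B_i|\ge cn$ for $i=1,\dots,m$. Then: (1) there exist vertices $a\in A$ and $b_i\in B_i$ ($i=1,\dots,m$) such that $a$ is adjacent to each of $b_1,\dots,b_m$; (2) there exist vertices $r\in A$ and $u_i\in B_i$ ($i=1,\dots,m$) such that each of $u_1,\dots,u_m$ is adjacent to $r$; (3) for every integer $t$ with $1\le t\le m$, there exist vertices $r\in A$ and $s_i\in B_i$ ($i=1,\dots,m$) such that $r$ is adjacent to each of $s_1,\dots,s_t$ and each of $s_{t+1},\dots,s_m$ is adjacent to $r$.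
   Context: A tournament is an orientation of a complete graph; $u$ is adjacent to $v$ means $(u,v)$ is an arc. For disjoint $X,Y\subseteq V(T)$, $X$ is complete to $Y$ if every vertex of $X$ is adjacent to every vertex of $Y$. A pure pair in $T$ is an ordered pair $(A,B)$ of disjoint subsets of $V(T)$ with $A$ complete to $B$; its order is $\min(|A|,|B|)$. $\mathcal{P}(T)$ denotes the maximum order of a pure pair of $T$. For $\alpha>0$, $T$ is $\alpha$-coherent if $\mathcal{P}(T)<\alpha|V(T)|$.
   Formalization: The parameters c and α range over the positive rationals. -}

module Defs where

open import Data.Nat using (ℕ; _⊔_; _⊓_)
open import Data.Integer using (+_)
open import Data.Fin using (Fin)
open import Data.Fin.Subset using (Subset; _∈_; _∩_; ∣_∣; Empty)
open import Data.Rational using (ℚ; _/_; _*_; _<_)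
open import Data.Product using (_×_)
open import Relation.Binary.PropositionalEquality using (_≢_)
open import Relation.Nullary using (¬_)
open import Data.Sum using (_⊎_)

ℕtoℚ : ℕ → ℚ
ℕtoℚ k = + k / 1

-- A tournament on vertex set Fin n: an adjacency relation (u adjacent to v
-- means (u,v) is an arc) that is an orientation of the complete graph:
-- irreflexive, every pair of distinct vertices joined, and antisymmetric.
record Tournament (n : ℕ) : Set₁ where
  field
    adj      : Fin n → Fin n → Set
    irrefl   : ∀ u → ¬ adj u u
    total    : ∀ u v → u ≢ v → adj u v ⊎ adj v u
    antisym  : ∀ u v → adj u v → ¬ adj v u

Disjoint : ∀ {n} → Subset n → Subset n → Set
Disjoint X Y = Empty (X ∩ Y)

Complete : ∀ {n} → Tournament n → Subset n → Subset n → Set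
Complete T X Y = ∀ x y → x ∈ X → y ∈ Y → Tournament.adj T x y

PurePair : ∀ {n} → Tournament n → Subset n → Subset n → Set
PurePair T X Y = Disjoint X Y × Complete T X Y

order : ∀ {n} → Subset n → Subset n → ℕ
order X Y = ∣ X ∣ ⊓ ∣ Y ∣

-- T is α-coherent: P(T) < α |V(T)|, i.e. every pure pair (hence the
-- maximum one) has order < α n.
Coherent : ∀ {n} → ℚ → Tournament n → Set
Coherent {n} α T = ∀ X Y → PurePair T X Y → ℕtoℚ (order X Y) < α * ℕtoℚ n

-- For a tournament Tᵢ and a part Bᵢ, the vertices of A with no out-neighbour in Bᵢ
-- form a set Sᵢ such that (Bᵢ, Sᵢ) is a pure pair; as |Bᵢ| ≥ αn, coherence forces
-- |Sᵢ| < αn.  So the Sᵢ cover fewer than mαn < |A| vertices, and some vertex of A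
-- has an out-neighbour in every Bᵢ.  Applying this to T or its reverse, part by
-- part, gives each required pattern of arc directions.
module Submission where

open import Defs
open import Data.Bool using (Bool; true; false)
open import Data.Empty using (⊥-elim)
open import Data.Fin as Fin using (Fin; toℕ)
open import Data.Fin.Properties using (any?; all?; ¬∀⟶∃¬)
open import Data.Fin.Subset using (Subset; _∈_; _⊆_; ∣_∣; _∩_; _∪_; ⋃; inside; outside)
  renaming (⊥ to ∅)
open import Data.Fin.Subset.Properties
  using (_∈?_; ∩-comm; x∈p∩q⁺; x∈p∩q⁻; p∩q⊆p; x∈p∪q⁺; ∣p∣≤∣x∷p∣; p⊆q⇒∣p∣≤∣q∣; ∣⊥∣≡0; ∉⊥)
open import Data.Integer as ℤ using (+_; +≤+)
import Data.Integer.Properties as ℤₚ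
open import Data.List using (tabulate)
open import Data.List.Membership.Propositional using () renaming (_∈_ to _∈ₗ_)
open import Data.List.Membership.Propositional.Properties using (∈-tabulate⁺)
open import Data.List.Relation.Unary.Any using (here; there)
open import Data.Nat as ℕ using (ℕ; zero; suc; z≤n; s≤s; _⊓_; _≤_; _<_; _<?_)
import Data.Nat.Properties as ℕₚ
open import Data.Nat.Coprimality using (1-coprimeTo) renaming (sym to coprime-sym)
open import Data.Product using (Σ-syntax; _×_; _,_; proj₁; proj₂)
open import Data.Rational using (ℚ; 0ℚ; 1ℚ; mkℚ; _+_; _*_; nonNegative; *≤*)
  renaming (_≤_ to _≤ℚ_; _<_ to _<ℚ_)
open import Data.Rational.Properties
  using (↥p/↧p≡p; ≤-trans; toℚᵘ-injective; toℚᵘ-homo-+; <⇒≤; <-≤-trans; <-irrefl;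
         *-monoʳ-≤-nonNeg; +-mono-≤; +-monoˡ-<; *-distribʳ-+; *-identityˡ; *-zeroˡ; +-identityˡ;
         *-assoc; *-comm; module ≤-Reasoning)
import Data.Rational.Unnormalised as ℚᵘ
import Data.Rational.Unnormalised.Properties as ℚᵘ
open import Data.Sum using (_⊎_; inj₁; inj₂; [_,_]; swap)
open import Data.Vec using ([]; _∷_)
import Data.Vec as Vec
open import Data.Vec.Properties using (lookup∘tabulate; []=⇒lookup; lookup⇒[]=)
open import Function using (_∘_)
open import Relation.Binary.PropositionalEquality
  using (_≡_; _≢_; refl; sym; trans; cong; subst; module ≡-Reasoning)
open import Relation.Nullary using (¬_; Dec; yes; no; does; ¬?)
open import Relation.Nullary.Decidable using (_×-dec_; dec-true)
open import Relation.Unary using (Pred; Decidable)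

mkℚ-ℕ : ℕ → ℚ
mkℚ-ℕ k = mkℚ (+ k) 0 (coprime-sym (1-coprimeTo k))

-- ℕtoℚ k = + k / 1 is normalised through gcd k 1, so for variable k it is only
-- propositionally equal to the constructor form.
ℕtoℚ≡mkℚ-ℕ : ∀ k → ℕtoℚ k ≡ mkℚ-ℕ k
ℕtoℚ≡mkℚ-ℕ k = ↥p/↧p≡p (mkℚ-ℕ k)

ℕtoℚ-mono-≤ : ∀ {k l} → k ≤ l → ℕtoℚ k ≤ℚ ℕtoℚ l
ℕtoℚ-mono-≤ {k} {l} k≤l rewrite ℕtoℚ≡mkℚ-ℕ k | ℕtoℚ≡mkℚ-ℕ l =
  *≤* (ℤₚ.*-monoʳ-≤-nonNeg (+ 1) (+≤+ k≤l))

ℕtoℚ-nonNeg : ∀ k → 0ℚ ≤ℚ ℕtoℚ k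
ℕtoℚ-nonNeg k = ℕtoℚ-mono-≤ {l = k} z≤n

ℕtoℚ-+ : ∀ k l → ℕtoℚ (k ℕ.+ l) ≡ ℕtoℚ k + ℕtoℚ l
ℕtoℚ-+ k l rewrite ℕtoℚ≡mkℚ-ℕ k | ℕtoℚ≡mkℚ-ℕ l | ℕtoℚ≡mkℚ-ℕ (k ℕ.+ l) =
  toℚᵘ-injective
    (ℚᵘ.≃-trans (ℚᵘ.*≡* cross-multiplied) (ℚᵘ.≃-sym (toℚᵘ-homo-+ (mkℚ-ℕ k) (mkℚ-ℕ l))))
  where
  cross-multiplied : + (k ℕ.+ l) ℤ.* + 1 ≡ (+ k ℤ.* + 1 ℤ.+ + l ℤ.* + 1) ℤ.* + 1
  cross-multiplied
    rewrite ℤₚ.*-identityʳ (+ k) | ℤₚ.*-identityʳ (+ l) | ℤₚ.*-identityʳ (+ (k ℕ.+ l)) = refl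

ℕtoℚ-*-mono-≤ : ∀ {k l} {y} → 0ℚ ≤ℚ y → k ≤ l → ℕtoℚ k * y ≤ℚ ℕtoℚ l * y
ℕtoℚ-*-mono-≤ {y = y} 0≤y k≤l = *-monoʳ-≤-nonNeg y {{nonNegative 0≤y}} (ℕtoℚ-mono-≤ k≤l)

ℕtoℚ-suc-* : ∀ m y → ℕtoℚ (suc m) * y ≡ y + ℕtoℚ m * y
ℕtoℚ-suc-* m y = begin
  ℕtoℚ (1 ℕ.+ m) * y        ≡⟨ cong (_* y) (ℕtoℚ-+ 1 m) ⟩
  (1ℚ + ℕtoℚ m) * y         ≡⟨ *-distribʳ-+ y 1ℚ (ℕtoℚ m) ⟩
  1ℚ * y + ℕtoℚ m * y       ≡⟨ cong (_+ ℕtoℚ m * y) (*-identityˡ y) ⟩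
  y + ℕtoℚ m * y            ∎
  where open ≡-Reasoning

ℕtoℚ-*-<-suc : ∀ m {y} → 0ℚ <ℚ y → ℕtoℚ m * y <ℚ ℕtoℚ (suc m) * y
ℕtoℚ-*-<-suc m {y} 0<y = begin-strict
  ℕtoℚ m * y         ≡⟨ sym (+-identityˡ (ℕtoℚ m * y)) ⟩
  0ℚ + ℕtoℚ m * y    <⟨ +-monoˡ-< (ℕtoℚ m * y) 0<y ⟩
  y + ℕtoℚ m * y     ≡⟨ sym (ℕtoℚ-suc-* m y) ⟩
  ℕtoℚ (suc m) * y   ∎
  where open ≤-Reasoning

ℕtoℚ-⊓-< : ∀ a b {z} → ℕtoℚ (a ⊓ b) <ℚ z → z ≤ℚ ℕtoℚ a → ℕtoℚ b <ℚ z
ℕtoℚ-⊓-< a b a⊓b<z z≤a with ℕₚ.⊓-sel a b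
... | inj₁ a⊓b≡a = ⊥-elim (<-irrefl refl (<-≤-trans (subst (λ x → ℕtoℚ x <ℚ _) a⊓b≡a a⊓b<z) z≤a))
... | inj₂ a⊓b≡b = subst (λ x → ℕtoℚ x <ℚ _) a⊓b≡b a⊓b<z

module _ {n : ℕ} where

  toSubset : ∀ {ℓ} {P : Pred (Fin n) ℓ} → Decidable P → Subset n
  toSubset P? = Vec.tabulate (does ∘ P?)

  ∈-toSubset⁺ : ∀ {ℓ} {P : Pred (Fin n) ℓ} (P? : Decidable P) {x} → P x → x ∈ toSubset P?
  ∈-toSubset⁺ P? {x} px = lookup⇒[]= x _ (trans (lookup∘tabulate _ x) (dec-true (P? x) px))

  ∈-toSubset⁻ : ∀ {ℓ} {P : Pred (Fin n) ℓ} (P? : Decidable P) {x} → x ∈ toSubset P? → P x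
  ∈-toSubset⁻ P? {x} x∈ with P? x | trans (sym (lookup∘tabulate _ x)) ([]=⇒lookup x∈)
  ... | yes px | _  = px
  ... | no _   | ()

  Disjoint-sym : ∀ {X Y : Subset n} → Disjoint X Y → Disjoint Y X
  Disjoint-sym {X} {Y} X#Y (x , x∈Y∩X) = X#Y (x , subst (x ∈_) (∩-comm Y X) x∈Y∩X)

  Disjoint-⊆ˡ : ∀ {X Y Z : Subset n} → X ⊆ Y → Disjoint Y Z → Disjoint X Z
  Disjoint-⊆ˡ {X} {Y} {Z} X⊆Y Y#Z (x , x∈X∩Z) =
    let x∈X , x∈Z = x∈p∩q⁻ X Z x∈X∩Z in Y#Z (x , x∈p∩q⁺ (X⊆Y x∈X , x∈Z))

  Disjoint⇒≢ : ∀ {X Y : Subset n} {x y} → Disjoint X Y → x ∈ X → y ∈ Y → x ≢ y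
  Disjoint⇒≢ X#Y x∈X x∈Y refl = X#Y (_ , x∈p∩q⁺ (x∈X , x∈Y))

  ∈-⋃⁺ : ∀ {p : Subset n} {ps x} → p ∈ₗ ps → x ∈ p → x ∈ ⋃ ps
  ∈-⋃⁺ (here refl) x∈p = x∈p∪q⁺ (inj₁ x∈p)
  ∈-⋃⁺ (there p∈ps) x∈p = x∈p∪q⁺ (inj₂ (∈-⋃⁺ p∈ps x∈p))

∣p∪q∣≤∣p∣+∣q∣ : ∀ {n} (p q : Subset n) → ∣ p ∪ q ∣ ≤ ∣ p ∣ ℕ.+ ∣ q ∣
∣p∪q∣≤∣p∣+∣q∣ []            []           = z≤n
∣p∪q∣≤∣p∣+∣q∣ (outside ∷ p) (outside ∷ q) = ∣p∪q∣≤∣p∣+∣q∣ p q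
∣p∪q∣≤∣p∣+∣q∣ (outside ∷ p) (inside ∷ q)  =
  ℕₚ.≤-trans (s≤s (∣p∪q∣≤∣p∣+∣q∣ p q)) (ℕₚ.≤-reflexive (sym (ℕₚ.+-suc ∣ p ∣ ∣ q ∣)))
∣p∪q∣≤∣p∣+∣q∣ (inside ∷ p)  (b ∷ q)       =
  s≤s (ℕₚ.≤-trans (∣p∪q∣≤∣p∣+∣q∣ p q) (ℕₚ.+-monoʳ-≤ ∣ p ∣ (∣p∣≤∣x∷p∣ b q)))

∣⋃∣-≤ : ∀ {n m} {y} (S : Fin m → Subset n) → (∀ i → ℕtoℚ ∣ S i ∣ ≤ℚ y) →
        ℕtoℚ ∣ ⋃ (tabulate S) ∣ ≤ℚ ℕtoℚ m * y
∣⋃∣-≤ {n} {zero} {y} S _ = begin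
  ℕtoℚ ∣ ∅ {n} ∣   ≡⟨ cong ℕtoℚ (∣⊥∣≡0 n) ⟩
  0ℚ               ≡⟨ sym (*-zeroˡ y) ⟩
  0ℚ * y           ∎
  where open ≤-Reasoning
∣⋃∣-≤ {m = suc m} {y} S S≤y = begin
  ℕtoℚ ∣ S₀ ∪ ⋃ Ss ∣                 ≤⟨ ℕtoℚ-mono-≤ (∣p∪q∣≤∣p∣+∣q∣ S₀ (⋃ Ss)) ⟩
  ℕtoℚ (∣ S₀ ∣ ℕ.+ ∣ ⋃ Ss ∣)         ≡⟨ ℕtoℚ-+ ∣ S₀ ∣ ∣ ⋃ Ss ∣ ⟩
  ℕtoℚ (∣ S₀ ∣) + ℕtoℚ (∣ ⋃ Ss ∣)    ≤⟨ +-mono-≤ (S≤y Fin.zero)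
                                                 (∣⋃∣-≤ (S ∘ Fin.suc) (S≤y ∘ Fin.suc)) ⟩
  y + ℕtoℚ m * y                     ≡⟨ sym (ℕtoℚ-suc-* m y) ⟩
  ℕtoℚ (suc m) * y                   ∎
  where
  open ≤-Reasoning
  S₀ = S Fin.zero
  Ss = tabulate (S ∘ Fin.suc)

reverse : ∀ {n} → Tournament n → Tournament n
reverse T = record
  { adj     = λ u v → adj v u
  ; irrefl  = irrefl
  ; total   = λ u v u≢v → swap (total u v u≢v)
  ; antisym = λ u v → antisym v u
  }
  where open Tournament T

orient : ∀ {n} → Bool → Tournament n → Tournament n
orient true  T = T
orient false T = reverse T

orient-does : ∀ {n} (T : Tournament n) {p} {P : Set p} (P? : Dec P) {u v} →
              Tournament.adj (orient (does P?) T) u v →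
              (P → Tournament.adj T u v) × (¬ P → Tournament.adj T v u)
orient-does T (yes p)  uv = (λ _ → uv) , (λ ¬p → ⊥-elim (¬p p))
orient-does T (no ¬p)  vu = (λ p → ⊥-elim (¬p p)) , (λ _ → vu)

module _ {n} (T : Tournament n) where
  open Tournament T

  adj? : ∀ u v → Dec (adj u v)
  adj? u v with u Fin.≟ v
  ... | yes refl = no (irrefl u)
  ... | no u≢v with total u v u≢v
  ...   | inj₁ uv = yes uv
  ...   | inj₂ vu = no (antisym v u vu)

  ¬adj⇒adj : ∀ {u v} → u ≢ v → ¬ adj u v → adj v u
  ¬adj⇒adj {u} {v} u≢v ¬uv with total u v u≢v
  ... | inj₁ uv = ⊥-elim (¬uv uv)
  ... | inj₂ vu = vu

  no-arcs⇒pure : ∀ {X Y} → Disjoint X Y → (∀ x y → x ∈ X → y ∈ Y → ¬ adj x y) → PurePair T Y X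
  no-arcs⇒pure X#Y no-arcs =
    Disjoint-sym X#Y , λ y x y∈Y x∈X → ¬adj⇒adj (Disjoint⇒≢ X#Y x∈X y∈Y) (no-arcs x y x∈X y∈Y)

module _ {n} {α : ℚ} {T : Tournament n} (coh : Coherent α T) where
  open Tournament T

  coherent⇒0<αn : 0ℚ <ℚ α * ℕtoℚ n
  coherent⇒0<αn = subst (λ k → ℕtoℚ (k ⊓ k) <ℚ α * ℕtoℚ n) (∣⊥∣≡0 n)
    (coh ∅ ∅ ((λ (_ , x∈∅) → ∉⊥ (proj₁ (x∈p∩q⁻ ∅ ∅ x∈∅))) , λ _ _ x∈∅ _ → ⊥-elim (∉⊥ x∈∅)))

  reverse-coherent : Coherent α (reverse T)
  reverse-coherent X Y (X#Y , X⇒Y) = subst (λ k → ℕtoℚ k <ℚ α * ℕtoℚ n) (ℕₚ.⊓-comm ∣ Y ∣ ∣ X ∣)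
    (coh Y X (Disjoint-sym X#Y , λ y x y∈Y x∈X → X⇒Y x y x∈X y∈Y))

  orient-coherent : ∀ b → Coherent α (orient b T)
  orient-coherent true  = coh
  orient-coherent false = reverse-coherent

  no-arcs⇒small : ∀ {X Y} → Disjoint X Y → (∀ x y → x ∈ X → y ∈ Y → ¬ adj x y) →
                  α * ℕtoℚ n ≤ℚ ℕtoℚ ∣ Y ∣ → ℕtoℚ ∣ X ∣ <ℚ α * ℕtoℚ n
  no-arcs⇒small {X} {Y} X#Y no-arcs αn≤|Y| =
    ℕtoℚ-⊓-< ∣ Y ∣ ∣ X ∣ (coh Y X (no-arcs⇒pure T X#Y no-arcs)) αn≤|Y|

module _ {n m} {α : ℚ} (T : Fin m → Tournament n) (coh : ∀ i → Coherent α (T i))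
         (A : Subset n) (B : Fin m → Subset n) (A#B : ∀ i → Disjoint A (B i)) where

  HasOutNeighbour : Fin n → Fin m → Set
  HasOutNeighbour r i = Σ[ s ∈ Fin n ] (s ∈ B i × Tournament.adj (T i) r s)

  hasOutNeighbour? : ∀ r i → Dec (HasOutNeighbour r i)
  hasOutNeighbour? r i = any? (λ s → (s ∈? B i) ×-dec adj? (T i) r s)

  noOutNeighbour? : ∀ i r → Dec (¬ HasOutNeighbour r i)
  noOutNeighbour? i r = ¬? (hasOutNeighbour? r i)

  Stuck : Fin m → Subset n
  Stuck i = A ∩ toSubset (noOutNeighbour? i)

  Stuck-small : ∀ i → α * ℕtoℚ n ≤ℚ ℕtoℚ ∣ B i ∣ → ℕtoℚ ∣ Stuck i ∣ <ℚ α * ℕtoℚ n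
  Stuck-small i =
    no-arcs⇒small {α = α} {T = T i} (coh i) (Disjoint-⊆ˡ (p∩q⊆p A _) (A#B i)) no-arcs
    where
    no-arcs : ∀ x y → x ∈ Stuck i → y ∈ B i → ¬ Tournament.adj (T i) x y
    no-arcs x y x∈Stuck y∈B xy =
      ∈-toSubset⁻ (noOutNeighbour? i) (proj₂ (x∈p∩q⁻ A _ x∈Stuck)) (y , y∈B , xy)

  vertex-or-cover : (Σ[ r ∈ Fin n ] (r ∈ A × ∀ i → HasOutNeighbour r i)) ⊎ A ⊆ ⋃ (tabulate Stuck)
  vertex-or-cover with any? (λ r → (r ∈? A) ×-dec all? (hasOutNeighbour? r))
  ... | yes found = inj₁ found
  ... | no none   = inj₂ λ {r} r∈A →
    let i , ¬out = ¬∀⟶∃¬ m _ (hasOutNeighbour? r) (λ out → none (r , r∈A , out))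
    in ∈-⋃⁺ (∈-tabulate⁺ i) (x∈p∩q⁺ (r∈A , ∈-toSubset⁺ (noOutNeighbour? i) ¬out))

  out-neighbours-in-all-parts :
    ℕtoℚ m * (α * ℕtoℚ n) <ℚ ℕtoℚ ∣ A ∣ → (∀ i → α * ℕtoℚ n ≤ℚ ℕtoℚ ∣ B i ∣) →
    Σ[ r ∈ Fin n ] Σ[ s ∈ (Fin m → Fin n) ]
      (r ∈ A × (∀ i → s i ∈ B i) × (∀ i → Tournament.adj (T i) r (s i)))
  out-neighbours-in-all-parts mαn<|A| αn≤|B| =
    [ choose , ⊥-elim ∘ cover-too-small ] vertex-or-cover
    where
    choose : Σ[ r ∈ Fin n ] (r ∈ A × ∀ i → HasOutNeighbour r i) →
             Σ[ r ∈ Fin n ] Σ[ s ∈ (Fin m → Fin n) ]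
               (r ∈ A × (∀ i → s i ∈ B i) × (∀ i → Tournament.adj (T i) r (s i)))
    choose (r , r∈A , out) = r , proj₁ ∘ out , r∈A , proj₁ ∘ proj₂ ∘ out , proj₂ ∘ proj₂ ∘ out

    cover-too-small : ¬ A ⊆ ⋃ (tabulate Stuck)
    cover-too-small A⊆⋃Stuck = <-irrefl refl (<-≤-trans mαn<|A| (begin
      ℕtoℚ ∣ A ∣                   ≤⟨ ℕtoℚ-mono-≤ (p⊆q⇒∣p∣≤∣q∣ A⊆⋃Stuck) ⟩
      ℕtoℚ ∣ ⋃ (tabulate Stuck) ∣  ≤⟨ ∣⋃∣-≤ Stuck (λ i → <⇒≤ (Stuck-small i (αn≤|B| i))) ⟩
      ℕtoℚ m * (α * ℕtoℚ n)        ∎))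
      where open ≤-Reasoning

scaled-≤ : ∀ α {c} k {N} → 0ℚ ≤ℚ N → α * ℕtoℚ k ≤ℚ c → ℕtoℚ k * (α * N) ≤ℚ c * N
scaled-≤ α {c} k {N} 0≤N αk≤c = begin
  ℕtoℚ k * (α * N)  ≡⟨ sym (*-assoc (ℕtoℚ k) α N) ⟩
  ℕtoℚ k * α * N    ≡⟨ cong (_* N) (*-comm (ℕtoℚ k) α) ⟩
  α * ℕtoℚ k * N    ≤⟨ *-monoʳ-≤-nonNeg N {{nonNegative 0≤N}} αk≤c ⟩
  c * N             ∎
  where open ≤-Reasoning

m*αn<c*n : ∀ α {c} m n → 0ℚ <ℚ α * ℕtoℚ n → α * ℕtoℚ (suc m) ≤ℚ c →
           ℕtoℚ m * (α * ℕtoℚ n) <ℚ c * ℕtoℚ n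
m*αn<c*n α m n 0<αn α[m+1]≤c =
  <-≤-trans (ℕtoℚ-*-<-suc m 0<αn) (scaled-≤ α (suc m) (ℕtoℚ-nonNeg n) α[m+1]≤c)

αn≤c*n : ∀ α {c} m n → 0ℚ ≤ℚ α * ℕtoℚ n → α * ℕtoℚ (suc m) ≤ℚ c → α * ℕtoℚ n ≤ℚ c * ℕtoℚ n
αn≤c*n α {c} m n 0≤αn α[m+1]≤c = begin
  α * ℕtoℚ n                    ≡⟨ sym (*-identityˡ (α * ℕtoℚ n)) ⟩
  ℕtoℚ 1 * (α * ℕtoℚ n)         ≤⟨ ℕtoℚ-*-mono-≤ 0≤αn (ℕₚ.m≤m+n 1 m) ⟩
  ℕtoℚ (suc m) * (α * ℕtoℚ n)   ≤⟨ scaled-≤ α (suc m) (ℕtoℚ-nonNeg n) α[m+1]≤c ⟩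
  c * ℕtoℚ n                    ∎
  where open ≤-Reasoning

lemma8 : (c α : ℚ) → 0ℚ <ℚ c → 0ℚ <ℚ α →
         (m : ℕ) → 1 ≤ m → α * ℕtoℚ (suc m) ≤ℚ c →
         (n : ℕ) (T : Tournament n) → Coherent α T →
         (A : Subset n) (B : Fin m → Subset n) →
         (∀ i → Disjoint A (B i)) →
         (∀ i j → i ≢ j → Disjoint (B i) (B j)) →
         c * ℕtoℚ n ≤ℚ ℕtoℚ ∣ A ∣ →
         (∀ i → c * ℕtoℚ n ≤ℚ ℕtoℚ ∣ B i ∣) →
         (Σ[ a ∈ Fin n ] Σ[ b ∈ (Fin m → Fin n) ] (a ∈ A × (∀ i → b i ∈ B i) × (∀ i → Tournament.adj T a (b i))))
         × (Σ[ r ∈ Fin n ] Σ[ u ∈ (Fin m → Fin n) ] (r ∈ A × (∀ i → u i ∈ B i) × (∀ i → Tournament.adj T (u i) r)))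
         × ((t : ℕ) → 1 ≤ t → t ≤ m →
             Σ[ r ∈ Fin n ] Σ[ s ∈ (Fin m → Fin n) ] (r ∈ A × (∀ i → s i ∈ B i)
               × (∀ i → toℕ i < t → Tournament.adj T r (s i))
               × (∀ i → t ≤ toℕ i → Tournament.adj T (s i) r)))
lemma8 c α _ _ m _ α[m+1]≤c n T coh A B A#B _ cn≤|A| cn≤|B| =
  oriented (λ _ → true) , oriented (λ _ → false) , λ t _ _ → split t
  where
  0<αn : 0ℚ <ℚ α * ℕtoℚ n
  0<αn = coherent⇒0<αn {α = α} {T = T} coh

  oriented : (dir : Fin m → Bool) →
             Σ[ r ∈ Fin n ] Σ[ s ∈ (Fin m → Fin n) ]
               (r ∈ A × (∀ i → s i ∈ B i) × (∀ i → Tournament.adj (orient (dir i) T) r (s i)))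
  oriented dir =
    out-neighbours-in-all-parts {α = α} (λ i → orient (dir i) T)
      (orient-coherent {α = α} {T = T} coh ∘ dir) A B A#B
      (<-≤-trans (m*αn<c*n α m n 0<αn α[m+1]≤c) cn≤|A|)
      (≤-trans (αn≤c*n α m n (<⇒≤ 0<αn) α[m+1]≤c) ∘ cn≤|B|)

  split : ∀ t → Σ[ r ∈ Fin n ] Σ[ s ∈ (Fin m → Fin n) ] (r ∈ A × (∀ i → s i ∈ B i)
                  × (∀ i → toℕ i < t → Tournament.adj T r (s i))
                  × (∀ i → t ≤ toℕ i → Tournament.adj T (s i) r))
  split t =
    let r , s , r∈A , s∈B , arcs = oriented (λ i → does (toℕ i <? t))
    in r , s , r∈A , s∈B , (λ i → proj₁ (orient-does T (toℕ i <? t) (arcs i)))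
                         , (λ i t≤i → proj₂ (orient-does T (toℕ i <? t) (arcs i)) (ℕₚ.≤⇒≯ t≤i))
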